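{- Let $H$ be a finite digraph and let $a,b,c$ be three distinct vertices of $H$ such that the weak component of $H^*$ containing $(a,b)$ contains neither $(a,c)$ nor $(c,b)$. Let $A,B,C$ be pairwise congruent walks in $H$ starting at $a,b,c$ respectively. If $A$ and $B$ avoid each other, then $B$ and $C$ avoid each other, and $A$ and $C$ avoid each other.
   Context: A walk $x_0,\dots,x_n$ in $H$ is a sequence of vertices where each $x_ix_{i+1}$ is either a forward arc ($x_ix_{i+1}\in A(H)$) or a backward arc ($x_{i+1}x_i\in A(H)$), with a designated choice. Walks $P=x_0,\dots,x_n$, $Q=y_0,\dots,y_n$ are congruent if $x_ix_{i+1}$ is forward iff $y_iy_{i+1}$ is forward. For congruent $P,Q$, $x_iy_{i+1}$ is a faithful arc from $P$ to $Q$ if it is a forward (resp. backward) arc when $x_ix_{i+1}$ is forward (resp. backward); $y_ix_{i+1}$ is a faithful arc from $Q$ to $P$ if it is forward (resp. backward) when $x_ix_{i+1}$ is forward (resp. backward). $P,Q$ avoid each other if for no $i\in\{0,\dots,n-1\}$ are both $x_iy_{i+1}$ and $y_ix_{i+1}$ faithful arcs. The digraph $H^*$ has as vertices all ordered pairs $(x,y)$ of distinct vertices of $H$, with an arc from $(x,y)$ to $(x',y')$ iff $xx'\in A(H)$ and $yy'\in A(H)$ but not both $xy'$ and $yx'$ are in $A(H)$. Weak components are components of the underlying undirected graph. -}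

module Defs where

open import Data.Nat using (ℕ; suc)
open import Data.Fin using (Fin; zero; suc; inject₁)
open import Data.Product using (_×_; _,_)
open import Relation.Nullary using (¬_)
open import Relation.Binary.PropositionalEquality using (_≡_; _≢_)
open import Relation.Binary.Construct.Closure.Symmetric using (SymClosure)
open import Relation.Binary.Construct.Closure.ReflexiveTransitive using (Star)

record Digraph : Set₁ where
  field
    size : ℕ
    Arc  : Fin size → Fin size → Set

module _ (H : Digraph) where
  open Digraph H

  V : Set
  V = Fin size

  -- direction of a step of a walk (the "designated choice")
  data Dir : Set where
    forward backward : Dir

  ArcIn : Dir → V → V → Set
  ArcIn forward  u v = Arc u v
  ArcIn backward u v = Arc v u

  -- a walk x_0,…,x_n of length n with designated directions
  record Walk (n : ℕ) : Set where
    field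
      vtx   : Fin (suc n) → V
      dir   : Fin n → Dir
      valid : ∀ (i : Fin n) → ArcIn (dir i) (vtx (inject₁ i)) (vtx (suc i))
  open Walk public

  start : ∀ {n} → Walk n → V
  start P = vtx P zero

  Congruent : ∀ {n} → Walk n → Walk n → Set
  Congruent P Q = ∀ i → dir P i ≡ dir Q i

  FaithfulPQ : ∀ {n} → Walk n → Walk n → Fin n → Set
  FaithfulPQ P Q i = ArcIn (dir P i) (vtx P (inject₁ i)) (vtx Q (suc i))

  FaithfulQP : ∀ {n} → Walk n → Walk n → Fin n → Set
  FaithfulQP P Q i = ArcIn (dir P i) (vtx Q (inject₁ i)) (vtx P (suc i))

  Avoid : ∀ {n} → Walk n → Walk n → Set
  Avoid P Q = ∀ i → ¬ (FaithfulPQ P Q i × FaithfulQP P Q i)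

  -- H*: vertices are ordered pairs of distinct vertices; arcs as in the paper
  StarArc : (V × V) → (V × V) → Set
  StarArc (x , y) (x' , y') =
    x ≢ y × x' ≢ y' × Arc x x' × Arc y y' × ¬ (Arc x y' × Arc y x')

  SameWeakComponent : (V × V) → (V × V) → Set
  SameWeakComponent = Star (SymClosure StarArc)

module Submission where

-- Run the three congruent walks A, B, C in lock-step, and let
-- x, y, z be their current vertices.  We maintain the invariant "aligned":
-- x, y, z are pairwise distinct and
--     (x , y) ∼ (a , b),   (x , z) ∼ (a , c),   (z , y) ∼ (c , b)
-- where ∼ is "same weak component of H*".
-- One step of the walks in a common direction d, without both faithful
-- arcs between two of them, is an arc of H* (forward or backward) between
-- the corresponding pairs.  If B and C (or A and C) had both faithful arcs
-- at some step, a short case analysis produces such H*-arcs joining (a , b)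
-- to (a , c) or to (c , b), contradicting the separation hypothesis; hence
-- they avoid each other at that step, and the invariant propagates.  The
-- case A/C is reduced to the case B/C by the symmetry (u , v) ↦ (v , u) of
-- H*, which exchanges the roles of a and b.

open import Defs
open import Data.Nat using (ℕ)
open import Data.Fin using (suc; inject₁)
open import Data.Fin.Induction using (<-weakInduction)
open import Data.Product using (_×_; _,_; proj₂; swap)
open import Function using (_∘_)
open import Relation.Nullary using (¬_)
open import Relation.Binary.PropositionalEquality using (_≡_; _≢_; refl; sym; subst)
import Relation.Binary.Construct.Closure.Symmetric as Sym
open import Relation.Binary.Construct.Closure.ReflexiveTransitive as Star using (ε; _◅_; _◅◅_)

module _ (H : Digraph) where

  private
    variable
      n : ℕ
      a b c x y z x' y' z' : V H
      p q r : V H × V H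

  Link : V H × V H → V H × V H → Set
  Link = Sym.SymClosure (StarArc H)

  _∼_ : V H × V H → V H × V H → Set
  _∼_ = SameWeakComponent H

  ∼-sym : p ∼ q → q ∼ p
  ∼-sym = Star.reverse (Sym.symmetric (StarArc H))

  _▷_ : p ∼ q → Link q r → p ∼ r
  s ▷ l = s ◅◅ (l ◅ ε)

  StarArc-swap : StarArc H p q → StarArc H (swap p) (swap q)
  StarArc-swap {_ , _} {_ , _} (x≢y , x'≢y' , xx' , yy' , noCross) =
    x≢y ∘ sym , x'≢y' ∘ sym , yy' , xx' , noCross ∘ swap

  ∼-swap : p ∼ q → swap p ∼ swap q
  ∼-swap = Star.gmap swap (Sym.gmap swap StarArc-swap)

  Crossed : Dir H → V H → V H → V H → V H → Set
  Crossed d u v u' v' = ArcIn H d u v' × ArcIn H d v u'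

  link : (d : Dir H) → x ≢ y → x' ≢ y' → ArcIn H d x x' → ArcIn H d y y'
       → ¬ Crossed d x y x' y' → Link (x , y) (x' , y')
  link forward  x≢y x'≢y' xx' yy' noCross = Sym.fwd (x≢y , x'≢y' , xx' , yy' , noCross)
  link backward x≢y x'≢y' xx' yy' noCross =
    Sym.bwd (x'≢y' , x≢y , xx' , yy' , noCross ∘ swap)

  uncrossed⇒distinct : (d : Dir H) → ArcIn H d x x' → ArcIn H d y y'
                     → ¬ Crossed d x y x' y' → x' ≢ y'
  uncrossed⇒distinct {x = x} {y = y} d xx' yy' noCross x'≡y' =
    noCross (subst (ArcIn H d x) x'≡y' xx' , subst (ArcIn H d y) (sym x'≡y') yy')

  Separated : V H → V H → V H → Set
  Separated a b c = ¬ (a , b) ∼ (a , c) × ¬ (a , b) ∼ (c , b)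

  Separated-swap : Separated a b c → Separated b a c
  Separated-swap (ab≁ac , ab≁cb) = ab≁cb ∘ ∼-swap , ab≁ac ∘ ∼-swap

  record Aligned (a b c x y z : V H) : Set where
    field
      x≢y   : x ≢ y
      x≢z   : x ≢ z
      z≢y   : z ≢ y
      ab∼xy : (a , b) ∼ (x , y)
      ac∼xz : (a , c) ∼ (x , z)
      cb∼zy : (c , b) ∼ (z , y)

  Aligned-swap : Aligned a b c x y z → Aligned b a c y x z
  Aligned-swap al = record
    { x≢y   = x≢y ∘ sym
    ; x≢z   = z≢y ∘ sym
    ; z≢y   = x≢z ∘ sym
    ; ab∼xy = ∼-swap ab∼xy
    ; ac∼xz = ∼-swap cb∼zy
    ; cb∼zy = ∼-swap ac∼xz
    }
    where open Aligned al

  -- A crossing would join (a , c) to (a , b) through (x' , y'),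
  -- unless x and z also cross towards (x' , y'); but then (a , b) and
  -- (c , b) are joined through (x' , z').
  uncrossed-BC : (d : Dir H) → Separated a b c → Aligned a b c x y z
               → ArcIn H d x x' → ArcIn H d y y' → ArcIn H d z z'
               → ¬ Crossed d x y x' y' → ¬ Crossed d y z y' z'
  uncrossed-BC {x = x} {y} {z} {x'} {y'} {z'} d (ab≁ac , ab≁cb) al xx' yy' zz' noAB (yz' , zy') =
    ab≁ac (ab∼xy ▷ link d x≢y x'≢y' xx' yy' noAB
           ◅◅ ∼-sym (ac∼xz ▷ link d x≢z x'≢y' xx' zy' noXZ))
    where
      open Aligned al
      x'≢y' : x' ≢ y'
      x'≢y' = uncrossed⇒distinct d xx' yy' noAB

      noXZ : ¬ Crossed d x z x' y'
      noXZ (xy' , zx') =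
        ab≁cb (ab∼xy ▷ link d x≢y x'≢z' xx' yz' (¬yx' ∘ proj₂)
               ◅◅ ∼-sym (cb∼zy ▷ link d z≢y x'≢z' zx' yz' (¬yx' ∘ proj₂)))
        where
          ¬yx' : ¬ ArcIn H d y x'
          ¬yx' yx' = noAB (xy' , yx')

          x'≢z' : x' ≢ z'
          x'≢z' x'≡z' = ¬yx' (subst (ArcIn H d y) (sym x'≡z') yz')

  uncrossed-AC : (d : Dir H) → Separated a b c → Aligned a b c x y z
               → ArcIn H d x x' → ArcIn H d y y' → ArcIn H d z z'
               → ¬ Crossed d x y x' y' → ¬ Crossed d x z x' z'
  uncrossed-AC d sep al xx' yy' zz' noAB =
    uncrossed-BC d (Separated-swap sep) (Aligned-swap al) yy' xx' zz' (noAB ∘ swap)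

  Aligned-step : (d : Dir H) → Separated a b c → Aligned a b c x y z
               → ArcIn H d x x' → ArcIn H d y y' → ArcIn H d z z'
               → ¬ Crossed d x y x' y' → Aligned a b c x' y' z'
  Aligned-step {x = x} {y} {z} {x'} {y'} {z'} d sep al xx' yy' zz' noAB = record
    { x≢y   = x'≢y'
    ; x≢z   = x'≢z'
    ; z≢y   = z'≢y'
    ; ab∼xy = ab∼xy ▷ link d x≢y x'≢y' xx' yy' noAB
    ; ac∼xz = ac∼xz ▷ link d x≢z x'≢z' xx' zz' noAC
    ; cb∼zy = cb∼zy ▷ link d z≢y z'≢y' zz' yy' noCB
    }
    where
      open Aligned al

      noAC : ¬ Crossed d x z x' z'
      noAC = uncrossed-AC d sep al xx' yy' zz' noAB

      noCB : ¬ Crossed d z y z' y'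
      noCB = uncrossed-BC d sep al xx' yy' zz' noAB ∘ swap

      x'≢y' : x' ≢ y'
      x'≢y' = uncrossed⇒distinct d xx' yy' noAB

      x'≢z' : x' ≢ z'
      x'≢z' = uncrossed⇒distinct d xx' zz' noAC

      z'≢y' : z' ≢ y'
      z'≢y' = uncrossed⇒distinct d zz' yy' noCB

  valid-along : (P Q : Walk H n) → Congruent H P Q
              → ∀ i → ArcIn H (dir P i) (vtx Q (inject₁ i)) (vtx Q (suc i))
  valid-along P Q PQ i =
    subst (λ d → ArcIn H d (vtx Q (inject₁ i)) (vtx Q (suc i))) (sym (PQ i)) (valid Q i)

  Aligned-along : Separated a b c → (A B C : Walk H n)
                → Congruent H A B → Congruent H A C → Avoid H A B
                → Aligned a b c (start H A) (start H B) (start H C)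
                → ∀ j → Aligned a b c (vtx A j) (vtx B j) (vtx C j)
  Aligned-along sep A B C AB AC noAB al₀ = <-weakInduction _ al₀ λ i al →
    Aligned-step (dir A i) sep al (valid A i) (valid-along A B AB i) (valid-along A C AC i) (noAB i)

lemma4 : (H : Digraph) (a b c : V H) → a ≢ b → b ≢ c → a ≢ c
         → ¬ SameWeakComponent H (a , b) (a , c)
         → ¬ SameWeakComponent H (a , b) (c , b)
         → {n : ℕ} (A B C : Walk H n)
         → start H A ≡ a → start H B ≡ b → start H C ≡ c
         → Congruent H A B → Congruent H B C → Congruent H A C
         → Avoid H A B
         → Avoid H B C × Avoid H A C
lemma4 H a b c a≢b b≢c a≢c ab≁ac ab≁cb A B C refl refl refl AB _ AC noAB =
  avoidBC , avoidAC
  where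
    sep : Separated H a b c
    sep = ab≁ac , ab≁cb

    al₀ : Aligned H a b c a b c
    al₀ = record { x≢y = a≢b ; x≢z = a≢c ; z≢y = b≢c ∘ sym
                 ; ab∼xy = ε ; ac∼xz = ε ; cb∼zy = ε }

    aligned : ∀ j → Aligned H a b c (vtx A j) (vtx B j) (vtx C j)
    aligned = Aligned-along H sep A B C AB AC noAB al₀

    avoidAC : Avoid H A C
    avoidAC i = uncrossed-AC H (dir A i) sep (aligned (inject₁ i))
      (valid A i) (valid-along H A B AB i) (valid-along H A C AC i) (noAB i)

    -- Avoidance of B and C is measured in the directions of B, equal to those of A.
    avoidBC : Avoid H B C
    avoidBC i = subst (λ d → ¬ Crossed H d (vtx B (inject₁ i)) (vtx C (inject₁ i))
                                           (vtx B (suc i)) (vtx C (suc i)))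
      (AB i)
      (uncrossed-BC H (dir A i) sep (aligned (inject₁ i))
        (valid A i) (valid-along H A B AB i) (valid-along H A C AC i) (noAB i))
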